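{- In the setting below, let $T_{\min}$ be an addition tree over $X$ of minimum cost. If $z$ is an internal node of $T_{\min}$ with $z<0$, then $z$ is of the form $\lambda H$ or $(-1/3+\lambda)H$.
   Context: Let $m,K$ be positive integers and $b_1,\ldots,b_{3m}$ positive integers with $K/4<b_i<K/2$ and $\sum_i b_i=mK$. Set $W=100(5m)^2K$, $a_i=b_i+W$, $L=3W+K$, $\varepsilon=1/(400(5m)^2)$, $h=\lfloor4\varepsilon L\rfloor$, $H=L+h$. Let $X$ be the multiset consisting of $a_1,\ldots,a_{3m}$, $m$ copies of $-H$ and $m$ copies of $h$. An addition tree over $X$ is a rooted full binary tree whose leaves are in bijection with the elements of $X$ (with multiplicity), labelled by them; a node's value is the sum of the labels of leaves in its subtree, and nodes are identified with their values. The cost is the sum of absolute values of internal nodes. Every node value $v$ of such a tree satisfies $|v/H-N/3|\le 1/(500m)$ for a unique integer $N$; we then say $v$ is of the form $(N/3+\lambda)H$ (with $|\lambda|\le1/(500m)$); "of the form $\lambda H$" means $N=0$. -}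

module Defs where

open import Data.Nat as ℕ using (ℕ; NonZero; _/_)
open import Data.Nat.Properties using (m*n≢0)
open import Data.Integer as ℤ using (ℤ; +_; -_; ∣_∣)
open import Data.Fin using (Fin)
open import Data.List using (List; []; _∷_; _++_; map; replicate; allFin)
open import Data.Nat.ListAction using (sum)

Wof : ℕ → ℕ → ℕ
Wof m K = 100 ℕ.* ((5 ℕ.* m) ℕ.* (5 ℕ.* m)) ℕ.* K

Lof : ℕ → ℕ → ℕ
Lof m K = 3 ℕ.* Wof m K ℕ.+ K

-- h = ⌊4 ε L⌋ with ε = 1/(400 (5m)^2), i.e. h = ⌊ L / (2500 m^2) ⌋.
hof : (m K : ℕ) → .{{NonZero m}} → ℕ
hof m K = _/_ (Lof m K) (2500 ℕ.* (m ℕ.* m)) {{m*n≢0 2500 (m ℕ.* m) {{_}} {{m*n≢0 m m}}}}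

Hof : (m K : ℕ) → .{{NonZero m}} → ℕ
Hof m K = Lof m K ℕ.+ hof m K

Xof : (m K : ℕ) → .{{NonZero m}} → (Fin (3 ℕ.* m) → ℕ) → List ℤ
Xof m K b =
  map (λ i → + (b i ℕ.+ Wof m K)) (allFin (3 ℕ.* m))
  ++ replicate m (- (+ Hof m K))
  ++ replicate m (+ hof m K)

data Tree : Set where
  leaf : ℤ → Tree
  node : Tree → Tree → Tree

leaves : Tree → List ℤ
leaves (leaf x)   = x ∷ []
leaves (node l r) = leaves l ++ leaves r

value : Tree → ℤ
value (leaf x)   = x
value (node l r) = value l ℤ.+ value r

internals : Tree → List ℤ
internals (leaf x)   = []
internals (node l r) = value (node l r) ∷ (internals l ++ internals r)

cost : Tree → ℕ
cost T = sum (map ∣_∣ (internals T))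

-- v is of the form (N/3 + λ)H with |λ| ≤ 1/(500m), i.e.
-- |v/H - N/3| ≤ 1/(500 m), equivalently |3v - N H| · 500 m ≤ 3 H  (H > 0).
FormOf : (m K : ℕ) → .{{NonZero m}} → ℤ → ℤ → Set
FormOf m K N v =
  ∣ (+ 3) ℤ.* v ℤ.- N ℤ.* (+ Hof m K) ∣ ℕ.* (500 ℕ.* m) ℕ.≤ 3 ℕ.* Hof m K

-- Every leaf is close to a multiple of H/3: a_i ≈ H/3, -H = -3·H/3 and h ≈ 0.  Writing
-- thirds t for that multiple at a node t (the N of the statement), the cost of a tree is
-- H/3 times its coarse cost, the sum of |thirds| over internal nodes, up to an error far
-- below H/3.  The tree built from m groups ((a a) -H) a has coarse cost 3m, so an optimal
-- tree has coarse cost at most 3m.  On the other hand, with a potential (the defect of a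
-- leaf, and of a cherry {-H, a}), 2·coarseCost = 6m + Σ excess, where every node has a
-- nonnegative excess; so in an optimal tree every node has excess 0.  At the parent of a
-- node with thirds ≤ -2 this forces the node to be a cherry {-H, a_i} whose sibling is a
-- leaf a_j, and exchanging -H with a_j lowers the cost since |a_i + a_j| < |a_i - H|.
-- Hence a negative internal node has thirds 0 or -1, and the approximation error bounds λ.

module Submission where

open import Defs
open import Data.Nat as ℕ using (ℕ; NonZero)
open import Data.Integer as ℤ using (ℤ; +_; -_)
open import Data.Fin using (Fin)
open import Data.List using (map; allFin)
open import Data.Nat.ListAction using (sum)
open import Data.List.Membership.Propositional using (_∈_)
open import Data.List.Relation.Binary.Permutation.Propositional using (_↭_)
open import Data.Sum using (_⊎_)
open import Relation.Binary.PropositionalEquality using (_≡_)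

open import Data.Nat using (zero; suc; _+_; _*_; _∸_; _⊔_; _≤_; _<_; z≤n; s≤s; >-nonZero)
open import Data.Nat.Properties
open import Data.Nat.ListAction.Properties using (sum-++; sum-↭)
open import Data.Nat.DivMod using (_/_; m*n/n≡m; /-monoˡ-≤)
open import Data.Integer using (-[1+_]; ∣_∣; _⊖_)
import Data.Integer.Properties as ℤ
open import Data.List using (List; []; _∷_; _++_; replicate; length)
open import Data.List.Properties using (map-++; length-++; length-map; length-replicate; length-tabulate)
open import Data.List.Membership.Propositional.Properties using (∈-++⁺ˡ; ∈-++⁺ʳ; ∈-++⁻; ∈-map⁻)
open import Data.List.Relation.Unary.Any using (here; there)
open import Data.List.Relation.Unary.All using (All; []; _∷_)
import Data.List.Relation.Unary.All.Properties as All
open import Data.List.Relation.Binary.Permutation.Propositional using (↭-refl; ↭-reflexive; ↭-prep; ↭-sym; ↭-trans; ↭-swap)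
import Data.List.Relation.Binary.Permutation.Propositional.Properties as ↭
open import Data.Sum using (inj₁; inj₂)
open import Data.Product using (_×_; _,_; ∃; ∃₂; proj₁; proj₂)
open import Function using (_∘_; id)
open import Relation.Binary.PropositionalEquality using (refl; sym; trans; subst; subst₂; cong; cong₂; module ≡-Reasoning)
open import Data.Nat.Tactic.RingSolver using (solve-∀)
import Data.Integer.Tactic.RingSolver as ℤSolver
open import Relation.Nullary using (¬_; yes; no; contradiction)
open import Data.Empty using (⊥; ⊥-elim)

-- Subtrees and replacement

infix 4 _⊑_

data _⊑_ (t : Tree) : Tree → Set where
  root  : t ⊑ t
  left  : ∀ {l r} → t ⊑ l → t ⊑ node l r
  right : ∀ {l r} → t ⊑ r → t ⊑ node l r

replaceAt : ∀ {t T} → t ⊑ T → Tree → Tree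
replaceAt root              t′ = t′
replaceAt (left {r = r} p)  t′ = node (replaceAt p t′) r
replaceAt (right {l = l} p) t′ = node l (replaceAt p t′)

data Parent (t s : Tree) : Tree → Set where
  onLeft  : Parent t s (node t s)
  onRight : Parent t s (node s t)

⊑-parent : ∀ {t T} → t ⊑ T → t ≡ T ⊎ ∃₂ λ s p → Parent t s p × p ⊑ T
⊑-parent root = inj₁ refl
⊑-parent (left {r = r} q) with ⊑-parent q
... | inj₁ refl              = inj₂ (r , _ , onLeft , root)
... | inj₂ (s , p , par , q′) = inj₂ (s , p , par , left q′)
⊑-parent (right {l = l} q) with ⊑-parent q
... | inj₁ refl              = inj₂ (l , _ , onRight , root)
... | inj₂ (s , p , par , q′) = inj₂ (s , p , par , right q′)

∈-leaves-⊑ : ∀ {t T x} → t ⊑ T → x ∈ leaves t → x ∈ leaves T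
∈-leaves-⊑ root              x∈ = x∈
∈-leaves-⊑ (left {r = r} p)  x∈ = ∈-++⁺ˡ (∈-leaves-⊑ p x∈)
∈-leaves-⊑ (right {l = l} p) x∈ = ∈-++⁺ʳ (leaves l) (∈-leaves-⊑ p x∈)

∈-internals⇒⊑ : ∀ {z} T → z ∈ internals T → ∃₂ λ l r → node l r ⊑ T × value (node l r) ≡ z
∈-internals⇒⊑ (node l r) (here z≡v) = l , r , root , sym z≡v
∈-internals⇒⊑ (node l r) (there z∈) with ∈-++⁻ (internals l) z∈
... | inj₁ z∈l with ∈-internals⇒⊑ l z∈l
...   | l′ , r′ , p , v≡z = l′ , r′ , left p , v≡z
∈-internals⇒⊑ (node l r) (there z∈) | inj₂ z∈r with ∈-internals⇒⊑ r z∈r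
...   | l′ , r′ , p , v≡z = l′ , r′ , right p , v≡z

cost-node : ∀ l r → cost (node l r) ≡ ∣ value (node l r) ∣ + (cost l + cost r)
cost-node l r = cong (λ c → ∣ value (node l r) ∣ + c)
  (trans (cong sum (map-++ ∣_∣ (internals l) (internals r))) (sum-++ (map ∣_∣ (internals l)) _))

value-replaceAt : ∀ {t T} (p : t ⊑ T) {t′} → value t′ ≡ value t → value (replaceAt p t′) ≡ value T
value-replaceAt root              eq = eq
value-replaceAt (left {r = r} p)  eq = cong (ℤ._+ value r) (value-replaceAt p eq)
value-replaceAt (right {l = l} p) eq = cong (λ v → value l ℤ.+ v) (value-replaceAt p eq)

leaves-replaceAt : ∀ {t T} (p : t ⊑ T) {t′} → leaves t′ ↭ leaves t → leaves (replaceAt p t′) ↭ leaves T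
leaves-replaceAt root              eq = eq
leaves-replaceAt (left {r = r} p)  eq = ↭.++⁺ʳ (leaves r) (leaves-replaceAt p eq)
leaves-replaceAt (right {l = l} p) eq = ↭.++⁺ˡ (leaves l) (leaves-replaceAt p eq)

cost-replaceAt : ∀ {t T} (p : t ⊑ T) {t′} → value t′ ≡ value t →
                 cost (replaceAt p t′) + cost t ≡ cost T + cost t′
cost-replaceAt root {t′} eq = +-comm (cost t′) _
cost-replaceAt {t} (left {l} {r} p) {t′} eq = begin
  cost (node (replaceAt p t′) r) + cost t
    ≡⟨ cong (_+ cost t) (cost-node (replaceAt p t′) r) ⟩
  ∣ value (replaceAt p t′) ℤ.+ value r ∣ + (c′ + cost r) + cost t
    ≡⟨ cong (λ v → ∣ v ℤ.+ value r ∣ + (c′ + cost r) + cost t) (value-replaceAt p eq) ⟩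
  k + (c′ + cost r) + cost t   ≡⟨ shuffle k c′ (cost r) (cost t) ⟩
  k + cost r + (c′ + cost t)   ≡⟨ cong (λ c → k + cost r + c) (cost-replaceAt p eq) ⟩
  k + cost r + (cost l + cost t′) ≡⟨ shuffle k (cost l) (cost r) (cost t′) ⟨
  k + (cost l + cost r) + cost t′ ≡⟨ cong (_+ cost t′) (cost-node l r) ⟨
  cost (node l r) + cost t′    ∎
  where open ≡-Reasoning
        k = ∣ value (node l r) ∣
        c′ = cost (replaceAt p t′)
        shuffle : ∀ k a e b → k + (a + e) + b ≡ k + e + (a + b)
        shuffle = solve-∀
cost-replaceAt {t} (right {l} {r} p) {t′} eq = begin
  cost (node l (replaceAt p t′)) + cost t
    ≡⟨ cong (_+ cost t) (cost-node l (replaceAt p t′)) ⟩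
  ∣ value l ℤ.+ value (replaceAt p t′) ∣ + (cost l + c′) + cost t
    ≡⟨ cong (λ v → ∣ value l ℤ.+ v ∣ + (cost l + c′) + cost t) (value-replaceAt p eq) ⟩
  k + (cost l + c′) + cost t   ≡⟨ shuffle k (cost l) c′ (cost t) ⟩
  k + cost l + (c′ + cost t)   ≡⟨ cong (λ c → k + cost l + c) (cost-replaceAt p eq) ⟩
  k + cost l + (cost r + cost t′) ≡⟨ shuffle k (cost l) (cost r) (cost t′) ⟨
  k + (cost l + cost r) + cost t′ ≡⟨ cong (_+ cost t′) (cost-node l r) ⟨
  cost (node l r) + cost t′    ∎
  where open ≡-Reasoning
        k = ∣ value (node l r) ∣
        c′ = cost (replaceAt p t′)
        shuffle : ∀ k a e b → k + (a + e) + b ≡ k + a + (e + b)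
        shuffle = solve-∀

leafSum : (ℤ → ℕ) → Tree → ℕ
leafSum f (leaf x)   = f x
leafSum f (node l r) = leafSum f l + leafSum f r

leafSum≡sum-leaves : ∀ f T → leafSum f T ≡ sum (map f (leaves T))
leafSum≡sum-leaves f (leaf x)   = sym (+-identityʳ (f x))
leafSum≡sum-leaves f (node l r) = begin
  leafSum f l + leafSum f r                              ≡⟨ cong₂ _+_ (leafSum≡sum-leaves f l) (leafSum≡sum-leaves f r) ⟩
  sum (map f (leaves l)) + sum (map f (leaves r))        ≡⟨ sum-++ (map f (leaves l)) _ ⟨
  sum (map f (leaves l) ++ map f (leaves r))             ≡⟨ cong sum (map-++ f (leaves l) (leaves r)) ⟨
  sum (map f (leaves l ++ leaves r))                     ∎
  where open ≡-Reasoning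

leafSum-↭ : ∀ f {T X} → leaves T ↭ X → leafSum f T ≡ sum (map f X)
leafSum-↭ f {T} T↭X = trans (leafSum≡sum-leaves f T) (sum-↭ (↭.map⁺ f T↭X))

leafSum-⊑ : ∀ f {t T} → t ⊑ T → leafSum f t ≤ leafSum f T
leafSum-⊑ f root                      = ≤-refl
leafSum-⊑ f (left {l} {r} p)  = ≤-trans (leafSum-⊑ f p) (m≤m+n (leafSum f l) (leafSum f r))
leafSum-⊑ f (right {l} {r} p) = ≤-trans (leafSum-⊑ f p) (m≤n+m (leafSum f r) (leafSum f l))

nodeSum : (Tree → Tree → ℕ) → Tree → ℕ
nodeSum f (leaf _)   = 0
nodeSum f (node l r) = f l r + (nodeSum f l + nodeSum f r)

nodeCount : Tree → ℕ
nodeCount = nodeSum (λ _ _ → 1)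

suc-nodeCount : ∀ T → suc (nodeCount T) ≡ length (leaves T)
suc-nodeCount (leaf x)   = refl
suc-nodeCount (node l r) = begin
  suc (suc (nodeCount l + nodeCount r)) ≡⟨ cong suc (+-suc (nodeCount l) (nodeCount r)) ⟨
  suc (nodeCount l) + suc (nodeCount r) ≡⟨ cong₂ _+_ (suc-nodeCount l) (suc-nodeCount r) ⟩
  length (leaves l) + length (leaves r) ≡⟨ length-++ (leaves l) ⟨
  length (leaves l ++ leaves r)         ∎
  where open ≡-Reasoning

nodeSum-⊑ : ∀ f {l r T} → node l r ⊑ T → f l r ≤ nodeSum f T
nodeSum-⊑ f root = m≤m+n _ _
nodeSum-⊑ f (left {l} {r} p) =
  ≤-trans (nodeSum-⊑ f p) (≤-trans (m≤m+n (nodeSum f l) (nodeSum f r)) (m≤n+m _ (f l r)))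
nodeSum-⊑ f (right {l} {r} p) =
  ≤-trans (nodeSum-⊑ f p) (≤-trans (m≤n+m (nodeSum f r) (nodeSum f l)) (m≤n+m _ (f l r)))

*-nodeSum : ∀ k f T → k * nodeSum f T ≡ nodeSum (λ l r → k * f l r) T
*-nodeSum k f (leaf _)   = *-zeroʳ k
*-nodeSum k f (node l r) = begin
  k * (f l r + (nodeSum f l + nodeSum f r))           ≡⟨ *-distribˡ-+ k (f l r) _ ⟩
  k * f l r + k * (nodeSum f l + nodeSum f r)         ≡⟨ cong (λ s → k * f l r + s) (*-distribˡ-+ k (nodeSum f l) _) ⟩
  k * f l r + (k * nodeSum f l + k * nodeSum f r)
    ≡⟨ cong (λ s → k * f l r + s) (cong₂ _+_ (*-nodeSum k f l) (*-nodeSum k f r)) ⟩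
  nodeSum (λ l r → k * f l r) (node l r)              ∎
  where open ≡-Reasoning

nodeSum-mono : ∀ {f g c} T → (∀ {l r} → node l r ⊑ T → f l r ≤ g l r + c) →
               nodeSum f T ≤ nodeSum g T + nodeCount T * c
nodeSum-mono (leaf _) _ = z≤n
nodeSum-mono {f} {g} {c} (node l r) f≤g = begin
  f l r + (nodeSum f l + nodeSum f r)
    ≤⟨ +-mono-≤ (f≤g root) (+-mono-≤ (nodeSum-mono l (f≤g ∘ left)) (nodeSum-mono r (f≤g ∘ right))) ⟩
  g l r + c + (nodeSum g l + nodeCount l * c + (nodeSum g r + nodeCount r * c))
    ≡⟨ regroup (g l r) c (nodeSum g l) (nodeCount l) (nodeSum g r) (nodeCount r) ⟩
  nodeSum g (node l r) + nodeCount (node l r) * c ∎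
  where open ≤-Reasoning
        regroup : ∀ a c gl nl gr nr →
          a + c + (gl + nl * c + (gr + nr * c)) ≡ a + (gl + gr) + suc (nl + nr) * c
        regroup = solve-∀

cost≡nodeSum : ∀ T → cost T ≡ nodeSum (λ l r → ∣ value (node l r) ∣) T
cost≡nodeSum (leaf x)   = refl
cost≡nodeSum (node l r) = trans (cost-node l r) (cong (λ c → ∣ value (node l r) ∣ + c) (cong₂ _+_ (cost≡nodeSum l) (cost≡nodeSum r)))

-- Optimal trees

Optimal : List ℤ → Tree → Set
Optimal X T = ∀ T′ → leaves T′ ↭ X → cost T ≤ cost T′

optimal-⊑ : ∀ {X T t t′} → leaves T ↭ X → Optimal X T → (p : t ⊑ T) →
            leaves t′ ↭ leaves t → value t′ ≡ value t → cost t ≤ cost t′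
optimal-⊑ {T = T} {t} {t′} T↭X opt p leaves≡ value≡ = +-cancelˡ-≤ (cost T) _ _ (begin
  cost T + cost t                 ≤⟨ +-monoˡ-≤ (cost t) (opt (replaceAt p t′) (↭-trans (leaves-replaceAt p leaves≡) T↭X)) ⟩
  cost (replaceAt p t′) + cost t  ≡⟨ cost-replaceAt p value≡ ⟩
  cost T + cost t′                ∎)
  where open ≤-Reasoning

data Cherry (x y : ℤ) : Tree → Set where
  xy : Cherry x y (node (leaf x) (leaf y))
  yx : Cherry x y (node (leaf y) (leaf x))

cherry-value : ∀ {x y z} → Cherry x y z → value z ≡ x ℤ.+ y
cherry-value         xy = refl
cherry-value {x} {y} yx = ℤ.+-comm y x

cherry-cost : ∀ {x y z} → Cherry x y z → cost z ≡ ∣ x ℤ.+ y ∣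
cherry-cost         xy = +-identityʳ _
cherry-cost {x} {y} yx = trans (+-identityʳ _) (cong ∣_∣ (ℤ.+-comm y x))

cherry-leaves : ∀ {x y z} → Cherry x y z → leaves z ↭ x ∷ y ∷ []
cherry-leaves         xy = ↭-refl
cherry-leaves {x} {y} yx = ↭-swap y x ↭-refl

module _ {w : ℤ} where

  parent-value : ∀ {t p} → Parent t (leaf w) p → value p ≡ value t ℤ.+ w
  parent-value         onLeft  = refl
  parent-value {t}     onRight = ℤ.+-comm w (value t)

  parent-cost : ∀ {t p} → Parent t (leaf w) p → cost p ≡ ∣ value p ∣ + cost t
  parent-cost {t} onLeft  = trans (cost-node t (leaf w)) (cong (λ c → ∣ value t ℤ.+ w ∣ + c) (+-identityʳ (cost t)))
  parent-cost {t} onRight = cost-node (leaf w) t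

  parent-leaves : ∀ {t p} → Parent t (leaf w) p → leaves p ↭ leaves t ++ w ∷ []
  parent-leaves     onLeft  = ↭-refl
  parent-leaves {t} onRight = ↭.++-comm (w ∷ []) (leaves t)

cherry-parent-leaves : ∀ {x y w z p} → Cherry x y z → Parent z (leaf w) p → leaves p ↭ x ∷ y ∷ w ∷ []
cherry-parent-leaves {w = w} c par = ↭-trans (parent-leaves par) (↭.++⁺ʳ (w ∷ []) (cherry-leaves c))

optimal-cherry : ∀ {X T x y w z p} → leaves T ↭ X → Optimal X T →
                 Cherry x y z → Parent z (leaf w) p → p ⊑ T → ∣ x ℤ.+ y ∣ ≤ ∣ y ℤ.+ w ∣
optimal-cherry {x = x} {y} {w} {z} {p} T↭X opt c par q = +-cancelˡ-≤ ∣ value p ∣ _ _ (begin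
  ∣ value p ∣ + ∣ x ℤ.+ y ∣         ≡⟨ trans (parent-cost par) (cong (λ k → ∣ value p ∣ + k) (cherry-cost c)) ⟨
  cost p                            ≤⟨ optimal-⊑ {t′ = rotated} T↭X opt q rotated-leaves rotated-value ⟩
  cost rotated                      ≡⟨ cong₂ (λ v c → ∣ v ∣ + c) rotated-value (+-identityʳ _) ⟩
  ∣ value p ∣ + ∣ y ℤ.+ w ∣         ∎)
  where
    open ≤-Reasoning
    rotated : Tree
    rotated = node (node (leaf y) (leaf w)) (leaf x)
    rotated-value : value rotated ≡ value p
    rotated-value = sym (trans (parent-value par) (trans (cong (ℤ._+ w) (cherry-value c)) (rotate x y w)))
      where rotate : ∀ x y w → x ℤ.+ y ℤ.+ w ≡ y ℤ.+ w ℤ.+ x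
            rotate = ℤSolver.solve-∀
    rotated-leaves : leaves rotated ↭ leaves p
    rotated-leaves = ↭-trans (↭.shift x (y ∷ w ∷ []) []) (↭-sym (cherry-parent-leaves c par))

∈-replicate⁻ : ∀ {A : Set} {x y : A} n → x ∈ replicate n y → x ≡ y
∈-replicate⁻ (suc n) (here x≡y) = x≡y
∈-replicate⁻ (suc n) (there x∈) = ∈-replicate⁻ n x∈

sum-map-replicate : ∀ {A : Set} (f : A → ℕ) n x → sum (map f (replicate n x)) ≡ n * f x
sum-map-replicate f zero    x = refl
sum-map-replicate f (suc n) x = cong (λ s → f x + s) (sum-map-replicate f n x)

sum-map-const : ∀ {A : Set} {f : A → ℕ} {c xs} → All (λ x → f x ≡ c) xs → sum (map f xs) ≡ length xs * c
sum-map-const []         = refl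
sum-map-const (fx≡c ∷ p) = cong₂ _+_ fx≡c (sum-map-const p)

sum-map-≤ : ∀ {A : Set} {f : A → ℕ} {c xs} → All (λ x → f x ≤ c) xs → sum (map f xs) ≤ length xs * c
sum-map-≤ []         = z≤n
sum-map-≤ (fx≤c ∷ p) = +-mono-≤ fx≤c (sum-map-≤ p)

data Triples {A : Set} : ℕ → List A → Set where
  []   : Triples 0 []
  cons : ∀ {k xs} x y z → Triples k xs → Triples (suc k) (x ∷ y ∷ z ∷ xs)

triples : ∀ {A : Set} k (xs : List A) → length xs ≡ 3 * k → Triples k xs
triples zero    []       _  = []
triples (suc k) xs       eq = split xs (trans eq (*-suc 3 k))
  where split : ∀ xs → length xs ≡ 3 + 3 * k → Triples (suc k) xs
        split (x ∷ y ∷ z ∷ xs) eq = cons x y z (triples k xs (suc-injective (suc-injective (suc-injective eq))))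

∣j∣≤∣i+j∣+∣i∣ : ∀ i j → ∣ j ∣ ≤ ∣ i ℤ.+ j ∣ + ∣ i ∣
∣j∣≤∣i+j∣+∣i∣ i j = subst (λ k → ∣ k ∣ ≤ ∣ i ℤ.+ j ∣ + ∣ i ∣) (cancel i j) (ℤ.∣i-j∣≤∣i∣+∣j∣ (i ℤ.+ j) i)
  where cancel : ∀ i j → (i ℤ.+ j) ℤ.- i ≡ j
        cancel = ℤSolver.solve-∀

∣i∣≤∣j∣+∣i-j∣ : ∀ i j → ∣ i ∣ ≤ ∣ j ∣ + ∣ i ℤ.- j ∣
∣i∣≤∣j∣+∣i-j∣ i j = subst (λ k → ∣ k ∣ ≤ ∣ j ∣ + ∣ i ℤ.- j ∣) (cancel i j) (ℤ.∣i+j∣≤∣i∣+∣j∣ j (i ℤ.- j))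
  where cancel : ∀ i j → j ℤ.+ (i ℤ.- j) ≡ i
        cancel = ℤSolver.solve-∀

∣j∣≤∣i∣+∣i-j∣ : ∀ i j → ∣ j ∣ ≤ ∣ i ∣ + ∣ i ℤ.- j ∣
∣j∣≤∣i∣+∣i-j∣ i j = subst (λ k → ∣ k ∣ ≤ ∣ i ∣ + ∣ i ℤ.- j ∣) (cancel i j) (ℤ.∣i-j∣≤∣i∣+∣j∣ i (i ℤ.- j))
  where cancel : ∀ i j → i ℤ.- (i ℤ.- j) ≡ j
        cancel = ℤSolver.solve-∀

H≤∣3i-[1+k]H∣ : ∀ H {i} k → i ℤ.< + 0 → H ≤ ∣ + 3 ℤ.* i ℤ.- + suc k ℤ.* + H ∣
H≤∣3i-[1+k]H∣ H {+ n}      k (ℤ.+<+ ())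
H≤∣3i-[1+k]H∣ H { -[1+ j ]} k _ = begin
  H                                                  ≤⟨ m≤m+n H (k * H) ⟩
  suc k * H                                          ≤⟨ m≤n+m (suc k * H) (3 * suc j) ⟩
  ∣ + (3 * suc j) ℤ.+ + (suc k * H) ∣                ≡⟨ cong ∣_∣ (cong₂ ℤ._+_ (ℤ.pos-* 3 (suc j)) (ℤ.pos-* (suc k) H)) ⟩
  ∣ + 3 ℤ.* + suc j ℤ.+ + suc k ℤ.* + H ∣            ≡⟨ ℤ.∣-i∣≡∣i∣ (+ 3 ℤ.* + suc j ℤ.+ + suc k ℤ.* + H) ⟨
  ∣ - (+ 3 ℤ.* + suc j ℤ.+ + suc k ℤ.* + H) ∣        ≡⟨ cong ∣_∣ (negate (+ suc j) (+ suc k) (+ H)) ⟨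
  ∣ + 3 ℤ.* -[1+ j ] ℤ.- + suc k ℤ.* + H ∣           ∎
  where open ≤-Reasoning
        negate : ∀ x y z → + 3 ℤ.* (- x) ℤ.- y ℤ.* z ≡ - (+ 3 ℤ.* x ℤ.+ y ℤ.* z)
        negate = ℤSolver.solve-∀

-- Counting thirds of H

data Kind : Set where
  large negative small : Kind

third : Kind → ℤ
third large    = + 1
third negative = -[1+ 2 ]
third small    = + 0

third⁺ third⁻ : Kind → ℕ
third⁺ large = 1
third⁺ _     = 0
third⁻ negative = 3
third⁻ _        = 0

third≡third⁺-third⁻ : ∀ k → third k ≡ + third⁺ k ℤ.- + third⁻ k
third≡third⁺-third⁻ large    = refl
third≡third⁺-third⁻ negative = refl
third≡third⁺-third⁻ small    = refl

cherryDefect : Kind → Kind → ℕ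
cherryDefect negative large    = 1
cherryDefect large    negative = 1
cherryDefect _        _        = 0

module Classification (h : ℕ) where

  kind : ℤ → Kind
  kind -[1+ _ ] = negative
  kind (+ n) with n ℕ.≤? h
  ... | yes _ = small
  ... | no _  = large

  kind-small : ∀ {n} → n ≤ h → kind (+ n) ≡ small
  kind-small {n} n≤h with n ℕ.≤? h
  ... | yes _  = refl
  ... | no n≰h = contradiction n≤h n≰h

  kind-large : ∀ {n} → h < n → kind (+ n) ≡ large
  kind-large {n} h<n with n ℕ.≤? h
  ... | yes n≤h = contradiction n≤h (<⇒≱ h<n)
  ... | no _    = refl

  thirds : Tree → ℤ
  thirds (leaf x)   = third (kind x)
  thirds (node l r) = thirds l ℤ.+ thirds r

  thirds≡leafSums : ∀ T → thirds T ≡ + leafSum (third⁺ ∘ kind) T ℤ.- + leafSum (third⁻ ∘ kind) T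
  thirds≡leafSums (leaf x)   = third≡third⁺-third⁻ (kind x)
  thirds≡leafSums (node l r) = begin
    thirds l ℤ.+ thirds r                          ≡⟨ cong₂ ℤ._+_ (thirds≡leafSums l) (thirds≡leafSums r) ⟩
    (+ pl ℤ.- + nl) ℤ.+ (+ pr ℤ.- + nr)            ≡⟨ regroup (+ pl) (+ nl) (+ pr) (+ nr) ⟩
    (+ pl ℤ.+ + pr) ℤ.- (+ nl ℤ.+ + nr)            ≡⟨ cong₂ ℤ._-_ (ℤ.pos-+ pl pr) (ℤ.pos-+ nl nr) ⟨
    + (pl + pr) ℤ.- + (nl + nr)                    ∎
    where open ≡-Reasoning
          pl = leafSum (third⁺ ∘ kind) l
          pr = leafSum (third⁺ ∘ kind) r
          nl = leafSum (third⁻ ∘ kind) l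
          nr = leafSum (third⁻ ∘ kind) r
          regroup : ∀ a b c d → (a ℤ.- b) ℤ.+ (c ℤ.- d) ≡ (a ℤ.+ c) ℤ.- (b ℤ.+ d)
          regroup = ℤSolver.solve-∀

  weight : Tree → ℕ
  weight = leafSum (λ x → ∣ third (kind x) ∣)

  coarseCost : Tree → ℕ
  coarseCost = nodeSum (λ l r → ∣ thirds (node l r) ∣)

  defect : Tree → ℕ
  defect (leaf x)                 = ∣ third (kind x) ∣
  defect (node (leaf x) (leaf y)) = cherryDefect (kind x) (kind y)
  defect (node _ _)               = 0

  data Defective : Tree → Set where
    largeLeaf    : ∀ {x} → kind x ≡ large → Defective (leaf x)
    negativeLeaf : ∀ {x} → kind x ≡ negative → Defective (leaf x)
    cherry       : ∀ {x y t} → kind x ≡ negative → kind y ≡ large → Cherry x y t → Defective t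

  defective : ∀ t → defect t ≡ 0 ⊎ Defective t
  defective (leaf x) with kind x in k
  ... | large    = inj₂ (largeLeaf k)
  ... | negative = inj₂ (negativeLeaf k)
  ... | small    = inj₁ refl
  defective (node (leaf x) (leaf y)) with kind x in k | kind y in k′
  ... | negative | large    = inj₂ (cherry k k′ xy)
  ... | large    | negative = inj₂ (cherry k′ k yx)
  ... | large    | large    = inj₁ refl
  ... | large    | small    = inj₁ refl
  ... | negative | negative = inj₁ refl
  ... | negative | small    = inj₁ refl
  ... | small    | _        = inj₁ refl
  defective (node (leaf _) (node _ _)) = inj₁ refl
  defective (node (node _ _) _)        = inj₁ refl

  cherry-thirds : ∀ {x y t} → kind x ≡ negative → kind y ≡ large → Cherry x y t → thirds t ≡ -[1+ 1 ]
  cherry-thirds kx ky xy rewrite kx | ky = refl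
  cherry-thirds kx ky yx rewrite kx | ky = refl

  cherry-defect : ∀ {x y t} → kind x ≡ negative → kind y ≡ large → Cherry x y t → defect t ≡ 1
  cherry-defect kx ky xy rewrite kx | ky = refl
  cherry-defect kx ky yx rewrite kx | ky = refl

  defect≤∣thirds∣ : ∀ t → defect t ≤ ∣ thirds t ∣
  defect≤∣thirds∣ t with defective t
  ... | inj₁ δ≡0                 rewrite δ≡0 = z≤n
  ... | inj₂ (largeLeaf k)       rewrite k = ≤-refl
  ... | inj₂ (negativeLeaf k)    rewrite k = ≤-refl
  ... | inj₂ (cherry kx ky c)    rewrite cherry-defect kx ky c | cherry-thirds kx ky c = s≤s z≤n

  defect-node≤1 : ∀ l r → defect (node l r) ≤ 1
  defect-node≤1 l r with defective (node l r)
  ... | inj₁ δ≡0              rewrite δ≡0 = z≤n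
  ... | inj₂ (cherry kx ky c) rewrite cherry-defect kx ky c = ≤-refl

  gain₀ loss : Tree → Tree → ℕ
  gain₀ l r = ∣ thirds l ℤ.+ thirds r ∣ + ∣ thirds l ∣ + ∣ thirds r ∣
  loss l r  = 2 * defect l + 2 * defect r

  gain : Tree → Tree → ℕ
  gain l r = gain₀ l r + 2 * defect (node l r)

  gain₀-comm : ∀ l r → gain₀ l r ≡ gain₀ r l
  gain₀-comm l r = begin
    ∣ Nl ℤ.+ Nr ∣ + ∣ Nl ∣ + ∣ Nr ∣  ≡⟨ cong (λ n → ∣ n ∣ + ∣ Nl ∣ + ∣ Nr ∣) (ℤ.+-comm Nl Nr) ⟩
    ∣ Nr ℤ.+ Nl ∣ + ∣ Nl ∣ + ∣ Nr ∣  ≡⟨ swap (∣ Nr ℤ.+ Nl ∣) (∣ Nl ∣) (∣ Nr ∣) ⟩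
    ∣ Nr ℤ.+ Nl ∣ + ∣ Nr ∣ + ∣ Nl ∣  ∎
    where open ≡-Reasoning
          Nl = thirds l
          Nr = thirds r
          swap : ∀ a b c → a + b + c ≡ a + c + b
          swap = solve-∀

  loss≤gain₀-comm : ∀ l r → loss r l ≤ gain₀ r l → loss l r ≤ gain₀ l r
  loss≤gain₀-comm l r = subst₂ _≤_ (+-comm (2 * defect r) (2 * defect l)) (gain₀-comm r l)

  2*defect≤gain₀ : ∀ l r → 2 * defect r ≤ gain₀ l r
  2*defect≤gain₀ l r = begin
    2 * defect r                ≤⟨ *-monoʳ-≤ 2 (defect≤∣thirds∣ r) ⟩
    ∣ Nr ∣ + (∣ Nr ∣ + 0)       ≡⟨ cong (λ n → ∣ Nr ∣ + n) (+-identityʳ ∣ Nr ∣) ⟩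
    ∣ Nr ∣ + ∣ Nr ∣             ≤⟨ +-monoˡ-≤ ∣ Nr ∣ (∣j∣≤∣i+j∣+∣i∣ Nl Nr) ⟩
    gain₀ l r                   ∎
    where open ≤-Reasoning
          Nl = thirds l
          Nr = thirds r

  cherry-loss≤gain₀ : ∀ {x y l r} → kind x ≡ negative → kind y ≡ large → Cherry x y l →
                      Defective r → loss l r ≤ gain₀ l r
  cherry-loss≤gain₀ kx ky c d rewrite cherry-thirds kx ky c | cherry-defect kx ky c = bound d
    where
      bound : ∀ {r} → Defective r → 2 * 1 + 2 * defect r ≤ ∣ -[1+ 1 ] ℤ.+ thirds r ∣ + 2 + ∣ thirds r ∣
      bound (largeLeaf k)       rewrite k = ≤-refl
      bound (negativeLeaf k)    rewrite k = ≤ᵇ⇒≤ _ _ _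
      bound (cherry kx′ ky′ c′) rewrite cherry-thirds kx′ ky′ c′ | cherry-defect kx′ ky′ c′ = ≤ᵇ⇒≤ _ _ _

  loss≤gain : ∀ l r → loss l r ≤ gain l r
  loss≤gain l r with defective l | defective r
  ... | inj₁ δl≡0 | _ rewrite δl≡0 = ≤-trans (2*defect≤gain₀ l r) (m≤m+n _ _)
  ... | inj₂ _ | inj₁ δr≡0 = ≤-trans (loss≤gain₀-comm l r right-bound) (m≤m+n _ _)
    where right-bound : loss r l ≤ gain₀ r l
          right-bound rewrite δr≡0 = 2*defect≤gain₀ r l
  ... | inj₂ (largeLeaf k)    | inj₂ (largeLeaf k′)    rewrite k | k′ = ≤-refl
  ... | inj₂ (largeLeaf k)    | inj₂ (negativeLeaf k′) rewrite k | k′ = ≤-refl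
  ... | inj₂ (negativeLeaf k) | inj₂ (largeLeaf k′)    rewrite k | k′ = ≤-refl
  ... | inj₂ (negativeLeaf k) | inj₂ (negativeLeaf k′) rewrite k | k′ = ≤-refl
  ... | inj₂ (cherry kx ky c) | inj₂ d = ≤-trans (cherry-loss≤gain₀ kx ky c d) (m≤m+n _ _)
  ... | inj₂ d | inj₂ (cherry kx ky c) = ≤-trans (loss≤gain₀-comm l r (cherry-loss≤gain₀ kx ky c d)) (m≤m+n _ _)

  -- The subtraction does not truncate, by loss≤gain.
  excess : Tree → ℕ
  excess = nodeSum (λ l r → gain l r ∸ loss l r)

  excess-identity : ∀ T → weight T + ∣ thirds T ∣ + excess T ≡ 2 * coarseCost T + 2 * defect T
  excess-identity (leaf x)   = leaf-case ∣ third (kind x) ∣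
    where leaf-case : ∀ a → a + a + 0 ≡ 2 * 0 + 2 * a
          leaf-case = solve-∀
  excess-identity (node l r) =
    node-case {weight l} {weight r} {∣ thirds l ∣} {∣ thirds r ∣} {excess l} {excess r}
              {coarseCost l} {coarseCost r} {defect l} {defect r}
              {∣ thirds (node l r) ∣} {defect (node l r)} {gain l r ∸ loss l r}
              (excess-identity l) (excess-identity r) (m∸n+n≡m (loss≤gain l r))
    where
      node-case : ∀ {wl wr nl nr el er cl cr dl dr N D x} →
        wl + nl + el ≡ 2 * cl + 2 * dl → wr + nr + er ≡ 2 * cr + 2 * dr →
        x + (2 * dl + 2 * dr) ≡ N + nl + nr + 2 * D →
        wl + wr + N + (x + (el + er)) ≡ 2 * (N + (cl + cr)) + 2 * D
      node-case {wl} {wr} {nl} {nr} {el} {er} {cl} {cr} {dl} {dr} {N} {D} {x} eqˡ eqʳ eqₓ =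
        +-cancelʳ-≡ _ _ _ (begin
          wl + wr + N + (x + (el + er)) + (nl + nr)               ≡⟨ split wl wr nl nr el er N x ⟩
          (wl + nl + el) + (wr + nr + er) + N + x                 ≡⟨ cong₂ (λ a b → a + b + N + x) eqˡ eqʳ ⟩
          (2 * cl + 2 * dl) + (2 * cr + 2 * dr) + N + x           ≡⟨ collect cl cr dl dr N x ⟩
          2 * cl + 2 * cr + N + (x + (2 * dl + 2 * dr))           ≡⟨ cong (λ g → 2 * cl + 2 * cr + N + g) eqₓ ⟩
          2 * cl + 2 * cr + N + (N + nl + nr + 2 * D)             ≡⟨ finish cl cr nl nr N D ⟩
          2 * (N + (cl + cr)) + 2 * D + (nl + nr)                 ∎)
        where
          open ≡-Reasoning
          split : ∀ wl wr nl nr el er N x →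
            wl + wr + N + (x + (el + er)) + (nl + nr) ≡ (wl + nl + el) + (wr + nr + er) + N + x
          split = solve-∀
          collect : ∀ cl cr dl dr N x →
            (2 * cl + 2 * dl) + (2 * cr + 2 * dr) + N + x ≡ 2 * cl + 2 * cr + N + (x + (2 * dl + 2 * dr))
          collect = solve-∀
          finish : ∀ cl cr nl nr N D →
            2 * cl + 2 * cr + N + (N + nl + nr + 2 * D) ≡ 2 * (N + (cl + cr)) + 2 * D + (nl + nr)
          finish = solve-∀

  Tight : Tree → Tree → Set
  Tight z s = gain₀ z s ≤ loss z s

  excess≡0⇒tight : ∀ {T z s p} → excess T ≡ 0 → Parent z s p → p ⊑ T → Tight z s
  excess≡0⇒tight {z = z} {s} ex≡0 onLeft  q = node-tight ex≡0 q
    where node-tight : ∀ {T l r} → excess T ≡ 0 → node l r ⊑ T → Tight l r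
          node-tight {T} {l} {r} ex≡0 q = ≤-trans (m≤m+n _ _) (m∸n≡0⇒m≤n (n≤0⇒n≡0
            (subst (gain l r ∸ loss l r ≤_) ex≡0 (nodeSum-⊑ (λ l r → gain l r ∸ loss l r) q))))
  excess≡0⇒tight {z = z} {s} ex≡0 onRight q =
    subst₂ _≤_ (gain₀-comm s z) (+-comm (2 * defect s) (2 * defect z)) (excess≡0⇒tight ex≡0 onLeft q)

  tight⇒∣thirds∣≤ : ∀ {z s} → Tight z s → ∣ thirds z ∣ ≤ defect z + defect s
  tight⇒∣thirds∣≤ {z} {s} tight = *-cancelˡ-≤ 2 (begin
    2 * ∣ Nz ∣                      ≡⟨ cong (λ n → ∣ Nz ∣ + n) (+-identityʳ (∣ Nz ∣)) ⟩
    ∣ Nz ∣ + ∣ Nz ∣                 ≤⟨ +-monoʳ-≤ (∣ Nz ∣) (∣j∣≤∣i+j∣+∣i∣ Ns Nz) ⟩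
    ∣ Nz ∣ + (∣ Ns ℤ.+ Nz ∣ + ∣ Ns ∣) ≡⟨ cong (λ i → ∣ Nz ∣ + (∣ i ∣ + ∣ Ns ∣)) (ℤ.+-comm Ns Nz) ⟩
    ∣ Nz ∣ + (∣ Nz ℤ.+ Ns ∣ + ∣ Ns ∣) ≡⟨ rotate (∣ Nz ∣) (∣ Nz ℤ.+ Ns ∣) (∣ Ns ∣) ⟩
    gain₀ z s                       ≤⟨ tight ⟩
    2 * defect z + 2 * defect s     ≡⟨ *-distribˡ-+ 2 (defect z) (defect s) ⟨
    2 * (defect z + defect s)       ∎)
    where open ≤-Reasoning
          Nz = thirds z
          Ns = thirds s
          rotate : ∀ a b c → a + (b + c) ≡ b + a + c
          rotate = solve-∀

  tight-negatives : ∀ {z s a b} → thirds z ≡ -[1+ a ] → thirds s ≡ -[1+ b ] → Tight z s →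
                    suc a + suc b ≤ defect z + defect s
  tight-negatives {z} {s} {a} {b} eqz eqs tight = *-cancelˡ-≤ 2 (begin
    2 * (suc a + suc b)                   ≡⟨ double a b ⟩
    suc (suc (a + b)) + suc a + suc b     ≡⟨ cong₂ (λ i j → ∣ i ℤ.+ j ∣ + ∣ i ∣ + ∣ j ∣) eqz eqs ⟨
    gain₀ z s                             ≤⟨ tight ⟩
    2 * defect z + 2 * defect s           ≡⟨ *-distribˡ-+ 2 (defect z) (defect s) ⟨
    2 * (defect z + defect s)             ∎)
    where open ≤-Reasoning
          double : ∀ a b → 2 * (suc a + suc b) ≡ suc (suc (a + b)) + suc a + suc b
          double = solve-∀

  Rotatable : Tree → Tree → Set
  Rotatable z s = ∃₂ λ x y → kind x ≡ negative × kind y ≡ large × Cherry x y z ×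
                             ∃ λ w → s ≡ leaf w × kind w ≡ large

  module _ {l r s n} (eq : thirds (node l r) ≡ -[1+ suc n ]) (tight : Tight (node l r) s) where

    private
      defects≤1-impossible : defect (node l r) + defect s ≤ 1 → ⊥
      defects≤1-impossible le with ≤-trans (subst (_≤ defect (node l r) + defect s) (cong ∣_∣ eq)
                                                  (tight⇒∣thirds∣≤ {node l r} {s} tight)) le
      ... | s≤s ()

      negative-sibling-impossible : ∀ {b} → thirds s ≡ -[1+ b ] → ⊥
      negative-sibling-impossible {b} eqs = ≤⇒≯ (tight-negatives {node l r} {s} eq eqs tight) (begin-strict
        defect (node l r) + defect s
          ≤⟨ +-mono-≤ (defect-node≤1 l r) (subst (λ i → defect s ≤ ∣ i ∣) eqs (defect≤∣thirds∣ s)) ⟩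
        1 + suc b                      <⟨ +-monoˡ-< (suc b) (s≤s (s≤s z≤n)) ⟩
        suc (suc n) + suc b            ∎)
        where open ≤-Reasoning

    tight-forces-rotatable : Rotatable (node l r) s
    tight-forces-rotatable with defective s
    ... | inj₁ δs≡0 = ⊥-elim (defects≤1-impossible
            (subst (λ d → defect (node l r) + d ≤ 1) (sym δs≡0) (≤-trans (≤-reflexive (+-identityʳ _)) (defect-node≤1 l r))))
    ... | inj₂ (negativeLeaf k)  = ⊥-elim (negative-sibling-impossible (cong third k))
    ... | inj₂ (cherry kx ky c)  = ⊥-elim (negative-sibling-impossible (cherry-thirds kx ky c))
    ... | inj₂ (largeLeaf {w} k) with defective (node l r)
    ...   | inj₁ δz≡0 = ⊥-elim (defects≤1-impossible (≤-reflexive (cong₂ _+_ δz≡0 (cong (∣_∣ ∘ third) k))))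
    ...   | inj₂ (cherry {x} {y} kx ky c) = x , y , kx , ky , c , w , refl , k

module Deviation (h H : ℕ) where
  open Classification h

  deviation : ℤ → ℕ
  deviation x = ∣ + 3 ℤ.* x ℤ.- third (kind x) ℤ.* + H ∣

  thirds-approximation : ∀ T → ∣ + 3 ℤ.* value T ℤ.- thirds T ℤ.* + H ∣ ≤ leafSum deviation T
  thirds-approximation (leaf x)   = ≤-refl
  thirds-approximation (node l r) = begin
    ∣ + 3 ℤ.* (value l ℤ.+ value r) ℤ.- (thirds l ℤ.+ thirds r) ℤ.* + H ∣
      ≡⟨ cong ∣_∣ (split (value l) (value r) (thirds l) (thirds r) (+ H)) ⟩
    ∣ (+ 3 ℤ.* value l ℤ.- thirds l ℤ.* + H) ℤ.+ (+ 3 ℤ.* value r ℤ.- thirds r ℤ.* + H) ∣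
      ≤⟨ ℤ.∣i+j∣≤∣i∣+∣j∣ (+ 3 ℤ.* value l ℤ.- thirds l ℤ.* + H) _ ⟩
    ∣ + 3 ℤ.* value l ℤ.- thirds l ℤ.* + H ∣ + ∣ + 3 ℤ.* value r ℤ.- thirds r ℤ.* + H ∣
      ≤⟨ +-mono-≤ (thirds-approximation l) (thirds-approximation r) ⟩
    leafSum deviation l + leafSum deviation r ∎
    where open ≤-Reasoning
          split : ∀ a b c d k → + 3 ℤ.* (a ℤ.+ b) ℤ.- (c ℤ.+ d) ℤ.* k ≡ (+ 3 ℤ.* a ℤ.- c ℤ.* k) ℤ.+ (+ 3 ℤ.* b ℤ.- d ℤ.* k)
          split = ℤSolver.solve-∀

  3∣value∣≤ : ∀ T → 3 * ∣ value T ∣ ≤ H * ∣ thirds T ∣ + leafSum deviation T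
  3∣value∣≤ T = subst₂ (λ a b → a ≤ b + leafSum deviation T)
    (ℤ.∣i*j∣≡∣i∣*∣j∣ (+ 3) (value T)) (trans (ℤ.∣i*j∣≡∣i∣*∣j∣ (thirds T) (+ H)) (*-comm ∣ thirds T ∣ H))
    (≤-trans (∣i∣≤∣j∣+∣i-j∣ (+ 3 ℤ.* value T) (thirds T ℤ.* + H)) (+-monoʳ-≤ _ (thirds-approximation T)))

  H∣thirds∣≤ : ∀ T → H * ∣ thirds T ∣ ≤ 3 * ∣ value T ∣ + leafSum deviation T
  H∣thirds∣≤ T = subst₂ (λ a b → a ≤ b + leafSum deviation T)
    (trans (ℤ.∣i*j∣≡∣i∣*∣j∣ (thirds T) (+ H)) (*-comm ∣ thirds T ∣ H)) (ℤ.∣i*j∣≡∣i∣*∣j∣ (+ 3) (value T))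
    (≤-trans (∣j∣≤∣i∣+∣i-j∣ (+ 3 ℤ.* value T) (thirds T ℤ.* + H)) (+-monoʳ-≤ _ (thirds-approximation T)))

  3*cost≤ : ∀ T → 3 * cost T ≤ H * coarseCost T + nodeCount T * leafSum deviation T
  3*cost≤ T = begin
    3 * cost T                                              ≡⟨ cong (3 *_) (cost≡nodeSum T) ⟩
    3 * nodeSum (λ l r → ∣ value (node l r) ∣) T            ≡⟨ *-nodeSum 3 _ T ⟩
    nodeSum (λ l r → 3 * ∣ value (node l r) ∣) T
      ≤⟨ nodeSum-mono T (λ {l} {r} p → ≤-trans (3∣value∣≤ (node l r)) (+-monoʳ-≤ _ (leafSum-⊑ deviation p))) ⟩
    nodeSum (λ l r → H * ∣ thirds (node l r) ∣) T + nodeCount T * leafSum deviation T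
      ≡⟨ cong (_+ nodeCount T * leafSum deviation T) (*-nodeSum H _ T) ⟨
    H * coarseCost T + nodeCount T * leafSum deviation T   ∎
    where open ≤-Reasoning

  H*coarseCost≤ : ∀ T → H * coarseCost T ≤ 3 * cost T + nodeCount T * leafSum deviation T
  H*coarseCost≤ T = begin
    H * coarseCost T                                        ≡⟨ *-nodeSum H _ T ⟩
    nodeSum (λ l r → H * ∣ thirds (node l r) ∣) T
      ≤⟨ nodeSum-mono T (λ {l} {r} p → ≤-trans (H∣thirds∣≤ (node l r)) (+-monoʳ-≤ _ (leafSum-⊑ deviation p))) ⟩
    nodeSum (λ l r → 3 * ∣ value (node l r) ∣) T + nodeCount T * leafSum deviation T
      ≡⟨ cong (_+ nodeCount T * leafSum deviation T) (trans (cong (3 *_) (cost≡nodeSum T)) (*-nodeSum 3 _ T)) ⟨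
    3 * cost T + nodeCount T * leafSum deviation T         ∎
    where open ≤-Reasoning

  nodeCount*deviation≤ : ∀ {T X} → leaves T ↭ X → nodeCount T * leafSum deviation T ≤ length X * sum (map deviation X)
  nodeCount*deviation≤ {T} T↭X = *-mono-≤
    (≤-trans (n≤1+n (nodeCount T)) (≤-reflexive (trans (suc-nodeCount T) (↭.↭-length T↭X))))
    (≤-reflexive (leafSum-↭ deviation {T} T↭X))

  coarseCost-optimal : ∀ {X T T′} → leaves T ↭ X → Optimal X T → leaves T′ ↭ X →
                       H * coarseCost T ≤ H * coarseCost T′ + 2 * (length X * sum (map deviation X))
  coarseCost-optimal {X} {T} {T′} T↭X opt T′↭X = begin
    H * coarseCost T                                   ≤⟨ H*coarseCost≤ T ⟩
    3 * cost T + nodeCount T * leafSum deviation T     ≤⟨ +-mono-≤ (*-monoʳ-≤ 3 (opt T′ T′↭X)) (nodeCount*deviation≤ {T} T↭X) ⟩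
    3 * cost T′ + err                                  ≤⟨ +-monoˡ-≤ err (3*cost≤ T′) ⟩
    H * coarseCost T′ + nodeCount T′ * leafSum deviation T′ + err
      ≤⟨ +-monoˡ-≤ err (+-monoʳ-≤ (H * coarseCost T′) (nodeCount*deviation≤ {T′} T′↭X)) ⟩
    H * coarseCost T′ + err + err                      ≡⟨ +-assoc (H * coarseCost T′) err err ⟩
    H * coarseCost T′ + (err + err)                    ≡⟨ cong (λ e → H * coarseCost T′ + (err + e)) (+-identityʳ err) ⟨
    H * coarseCost T′ + 2 * err                        ∎
    where open ≤-Reasoning
          err = length X * sum (map deviation X)

-- The instance X

-- W, h and H = 3W + K + h are kept abstract: only these inequalities about them are used.
module Construction (m′ K W h : ℕ) (b : Fin (3 * suc m′) → ℕ) (0<K : 0 < K) (2b<K : ∀ i → 2 * b i < K)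
                (K≤h : K ≤ h) (h≤4K : h ≤ 4 * K) (W-large : 2500 * (suc m′ * suc m′ * K) ≤ W) where

  open Classification h
  open Deviation h (3 * W + K + h)

  m H : ℕ
  m = suc m′
  H = 3 * W + K + h

  a : Fin (3 * m) → ℤ
  a i = + (b i + W)

  As Ms Hs X : List ℤ
  As = map a (allFin (3 * m))
  Ms = replicate m (- (+ H))
  Hs = replicate m (+ h)
  X  = As ++ Ms ++ Hs

  Q : ℕ
  Q = m * m * K

  K≤Q : K ≤ Q
  K≤Q = m≤n*m K (m * m)

  0<Q : 0 < Q
  0<Q = <-≤-trans 0<K K≤Q

  7500Q≤H : 7500 * Q ≤ H
  7500Q≤H = begin
    7500 * Q          ≡⟨ *-assoc 3 2500 Q ⟩
    3 * (2500 * Q)    ≤⟨ *-monoʳ-≤ 3 W-large ⟩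
    3 * W             ≤⟨ m≤m+n (3 * W) K ⟩
    3 * W + K         ≤⟨ m≤m+n (3 * W + K) h ⟩
    H                 ∎
    where open ≤-Reasoning

  0<H : 0 < H
  0<H = <-≤-trans (*-monoʳ-< 7500 0<Q) 7500Q≤H

  b≤K : ∀ i → b i ≤ K
  b≤K i = ≤-trans (m≤m+n (b i) (b i + 0)) (<⇒≤ (2b<K i))

  h<a : ∀ i → h < b i + W
  h<a i = begin-strict
    h            ≤⟨ h≤4K ⟩
    4 * K        <⟨ *-monoˡ-< K {{>-nonZero 0<K}} (≤ᵇ⇒≤ 5 2500 _) ⟩
    2500 * K     ≤⟨ *-monoʳ-≤ 2500 K≤Q ⟩
    2500 * Q     ≤⟨ W-large ⟩
    W            ≤⟨ m≤n+m W (b i) ⟩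
    b i + W      ∎
    where open ≤-Reasoning

  kind-a : ∀ i → kind (a i) ≡ large
  kind-a i = kind-large (h<a i)

  kind-H : kind (- (+ H)) ≡ negative
  kind-H = negative-kind 0<H
    where negative-kind : ∀ {n} → 0 < n → kind (- (+ n)) ≡ negative
          negative-kind {suc n} _ = refl

  kind-h : kind (+ h) ≡ small
  kind-h = kind-small ≤-refl

  ∈X⁻ : ∀ {x} → x ∈ X → (∃ λ i → x ≡ a i) ⊎ x ≡ - (+ H) ⊎ x ≡ + h
  ∈X⁻ x∈ with ∈-++⁻ As x∈
  ... | inj₁ x∈As with ∈-map⁻ a x∈As
  ...   | i , _ , x≡ai = inj₁ (i , x≡ai)
  ∈X⁻ x∈ | inj₂ x∈rest with ∈-++⁻ Ms x∈rest
  ...   | inj₁ x∈Ms = inj₂ (inj₁ (∈-replicate⁻ m x∈Ms))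
  ...   | inj₂ x∈Hs = inj₂ (inj₂ (∈-replicate⁻ m x∈Hs))

  negative∈X : ∀ {x} → x ∈ X → kind x ≡ negative → x ≡ - (+ H)
  negative∈X x∈ k with ∈X⁻ x∈
  ... | inj₁ (i , refl)     = contradiction (trans (sym (kind-a i)) k) λ ()
  ... | inj₂ (inj₁ x≡-H)    = x≡-H
  ... | inj₂ (inj₂ refl)    = contradiction (trans (sym kind-h) k) λ ()

  large∈X : ∀ {x} → x ∈ X → kind x ≡ large → ∃ λ i → x ≡ a i
  large∈X x∈ k with ∈X⁻ x∈
  ... | inj₁ x≡ai           = x≡ai
  ... | inj₂ (inj₁ refl)    = contradiction (trans (sym kind-H) k) λ ()
  ... | inj₂ (inj₂ refl)    = contradiction (trans (sym kind-h) k) λ ()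

  all-As : ∀ {P : ℤ → Set} → (∀ i → P (a i)) → All P As
  all-As Pa = All.map⁺ (All.tabulate⁺ Pa)

  length-As : length As ≡ 3 * m
  length-As = trans (length-map a (allFin (3 * m))) (length-tabulate id)

  length-X : length X ≡ 5 * m
  length-X = begin
    length (As ++ Ms ++ Hs)          ≡⟨ length-++ As ⟩
    length As + length (Ms ++ Hs)    ≡⟨ cong₂ _+_ length-As (trans (length-++ Ms) (cong₂ _+_ (length-replicate m) (length-replicate m))) ⟩
    3 * m + (m + m)                  ≡⟨ five m ⟩
    5 * m                            ∎
    where open ≡-Reasoning
          five : ∀ m → 3 * m + (m + m) ≡ 5 * m
          five = solve-∀

  sum-map-X : ∀ f → sum (map f X) ≡ sum (map f As) + (m * f (- (+ H)) + m * f (+ h))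
  sum-map-X f = begin
    sum (map f (As ++ Ms ++ Hs))                          ≡⟨ cong sum (map-++ f As (Ms ++ Hs)) ⟩
    sum (map f As ++ map f (Ms ++ Hs))                    ≡⟨ sum-++ (map f As) _ ⟩
    sum (map f As) + sum (map f (Ms ++ Hs))               ≡⟨ cong (λ s → sum (map f As) + s) (begin
      sum (map f (Ms ++ Hs))                              ≡⟨ cong sum (map-++ f Ms Hs) ⟩
      sum (map f Ms ++ map f Hs)                          ≡⟨ sum-++ (map f Ms) _ ⟩
      sum (map f Ms) + sum (map f Hs)                     ≡⟨ cong₂ _+_ (sum-map-replicate f m _) (sum-map-replicate f m _) ⟩
      m * f (- (+ H)) + m * f (+ h)                       ∎) ⟩
    sum (map f As) + (m * f (- (+ H)) + m * f (+ h))      ∎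
    where open ≡-Reasoning

  sum-kind-X : ∀ (g : Kind → ℕ) → sum (map (g ∘ kind) X) ≡ 3 * m * g large + (m * g negative + m * g small)
  sum-kind-X g = trans (sum-map-X (g ∘ kind)) (cong₂ _+_
    (trans (sum-map-const {f = g ∘ kind} (all-As (λ i → cong g (kind-a i)))) (cong (_* g large) length-As))
    (cong₂ (λ p q → m * g p + m * g q) kind-H kind-h))

  count-X : ∀ {T} (g : Kind → ℕ) {c} → leaves T ↭ X → 3 * m * g large + (m * g negative + m * g small) ≡ c →
            leafSum (g ∘ kind) T ≡ c
  count-X {T} g T↭X eq = trans (leafSum-↭ (g ∘ kind) {T} T↭X) (trans (sum-kind-X g) eq)

  thirds-X : ∀ {T} → leaves T ↭ X → thirds T ≡ + 0
  thirds-X {T} T↭X = begin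
    thirds T                                                     ≡⟨ thirds≡leafSums T ⟩
    + leafSum (third⁺ ∘ kind) T ℤ.- + leafSum (third⁻ ∘ kind) T
      ≡⟨ cong₂ (λ p q → + p ℤ.- + q) (count-X {T} third⁺ T↭X (up m)) (count-X {T} third⁻ T↭X (down m)) ⟩
    + (3 * m) ℤ.- + (3 * m)                                      ≡⟨ ℤ.+-inverseʳ (+ (3 * m)) ⟩
    + 0                                                          ∎
    where
      open ≡-Reasoning
      up : ∀ m → 3 * m * 1 + (m * 0 + m * 0) ≡ 3 * m
      up = solve-∀
      down : ∀ m → 3 * m * 0 + (m * 3 + m * 0) ≡ 3 * m
      down = solve-∀

  weight-X : ∀ {T} → leaves T ↭ X → weight T ≡ 6 * m
  weight-X {T} T↭X = count-X {T} (∣_∣ ∘ third) T↭X (total m)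
    where total : ∀ m → 3 * m * 1 + (m * 3 + m * 0) ≡ 6 * m
          total = solve-∀

  deviation-a : ∀ i → deviation (a i) ≤ 4 * K + h
  deviation-a i = begin
    deviation (a i)                              ≡⟨ cong (λ k → ∣ + 3 ℤ.* a i ℤ.- third k ℤ.* + H ∣) (kind-a i) ⟩
    ∣ + 3 ℤ.* + (b i + W) ℤ.- + 1 ℤ.* + H ∣      ≡⟨ cong ∣_∣ (cong₂ ℤ._-_ (sym (ℤ.pos-* 3 (b i + W))) (ℤ.*-identityˡ (+ H))) ⟩
    ∣ + (3 * (b i + W)) ℤ.- + H ∣                ≡⟨ cong ∣_∣ (ℤ.[+m]-[+n]≡m⊖n _ H) ⟩
    ∣ 3 * (b i + W) ⊖ H ∣                        ≡⟨ cong ∣_∣ (cong₂ _⊖_ (expand (b i) W) (+-assoc (3 * W) K h)) ⟩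
    ∣ 3 * W + 3 * b i ⊖ (3 * W + (K + h)) ∣      ≡⟨ cong ∣_∣ (ℤ.+-cancelˡ-⊖ (3 * W) (3 * b i) (K + h)) ⟩
    ∣ 3 * b i ⊖ (K + h) ∣                        ≤⟨ ℤ.∣m⊝n∣≤m⊔n (3 * b i) (K + h) ⟩
    3 * b i ⊔ (K + h)                            ≤⟨ m⊔n≤m+n (3 * b i) (K + h) ⟩
    3 * b i + (K + h)                            ≤⟨ +-monoˡ-≤ (K + h) (*-monoʳ-≤ 3 (b≤K i)) ⟩
    3 * K + (K + h)                              ≡⟨ collect K h ⟩
    4 * K + h                                    ∎
    where open ≤-Reasoning
          expand : ∀ b W → 3 * (b + W) ≡ 3 * W + 3 * b
          expand = solve-∀
          collect : ∀ K h → 3 * K + (K + h) ≡ 4 * K + h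
          collect = solve-∀

  deviation-H : deviation (- (+ H)) ≡ 0
  deviation-H = trans (cong (λ k → ∣ + 3 ℤ.* - (+ H) ℤ.- third k ℤ.* + H ∣) kind-H) (cong ∣_∣ (cancel (+ H)))
    where cancel : ∀ x → + 3 ℤ.* (- x) ℤ.- (- (+ 3)) ℤ.* x ≡ + 0
          cancel = ℤSolver.solve-∀

  deviation-h : deviation (+ h) ≡ 3 * h
  deviation-h = trans (cong (λ k → ∣ + 3 ℤ.* + h ℤ.- third k ℤ.* + H ∣) kind-h) (trans (cong ∣_∣ (drop (+ h) (+ H))) (ℤ.∣i*j∣≡∣i∣*∣j∣ (+ 3) (+ h)))
    where drop : ∀ x y → + 3 ℤ.* x ℤ.- + 0 ℤ.* y ≡ + 3 ℤ.* x
          drop = ℤSolver.solve-∀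

  budget : ℕ
  budget = 36 * (m * K)

  deviation-X : sum (map deviation X) ≤ budget
  deviation-X = begin
    sum (map deviation X)                                          ≡⟨ sum-map-X deviation ⟩
    sum (map deviation As) + (m * deviation (- (+ H)) + m * deviation (+ h))
      ≡⟨ cong₂ (λ p q → sum (map deviation As) + (m * p + m * q)) deviation-H deviation-h ⟩
    sum (map deviation As) + (m * 0 + m * (3 * h))
      ≤⟨ +-monoˡ-≤ _ (sum-map-≤ {f = deviation} (all-As deviation-a)) ⟩
    length As * (4 * K + h) + (m * 0 + m * (3 * h))
      ≡⟨ cong (λ n → n * (4 * K + h) + (m * 0 + m * (3 * h))) length-As ⟩
    3 * m * (4 * K + h) + (m * 0 + m * (3 * h))
      ≤⟨ +-mono-≤ (*-monoʳ-≤ (3 * m) (+-monoʳ-≤ (4 * K) h≤4K)) (+-monoʳ-≤ (m * 0) (*-monoʳ-≤ m (*-monoʳ-≤ 3 h≤4K))) ⟩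
    3 * m * (4 * K + 4 * K) + (m * 0 + m * (3 * (4 * K)))          ≡⟨ total m K ⟩
    budget                                                         ∎
    where open ≤-Reasoning
          total : ∀ m K → 3 * m * (4 * K + 4 * K) + (m * 0 + m * (3 * (4 * K))) ≡ 36 * (m * K)
          total = solve-∀

  budget≤36Q : budget ≤ 36 * Q
  budget≤36Q = *-monoʳ-≤ 36 (*-monoˡ-≤ K (m≤m*n m m))

  budget<H : budget < H
  budget<H = <-≤-trans (≤-<-trans budget≤36Q (*-monoˡ-< Q {{>-nonZero 0<Q}} (≤ᵇ⇒≤ 37 7500 _))) 7500Q≤H

  2*5m*budget<H : 2 * (5 * m * budget) < H
  2*5m*budget<H = begin-strict
    2 * (5 * m * budget)   ≡⟨ regroup m K ⟩
    360 * Q                <⟨ *-monoˡ-< Q {{>-nonZero 0<Q}} (≤ᵇ⇒≤ 361 7500 _) ⟩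
    7500 * Q               ≤⟨ 7500Q≤H ⟩
    H                      ∎
    where open ≤-Reasoning
          regroup : ∀ m K → 2 * (5 * m * (36 * (m * K))) ≡ 360 * (m * m * K)
          regroup = solve-∀

  budget*500m≤3H : budget * (500 * m) ≤ 3 * H
  budget*500m≤3H = begin
    budget * (500 * m)     ≡⟨ regroup m K ⟩
    18000 * Q              ≤⟨ *-monoˡ-≤ Q (≤ᵇ⇒≤ 18000 22500 _) ⟩
    22500 * Q              ≡⟨ *-assoc 3 7500 Q ⟩
    3 * (7500 * Q)         ≤⟨ *-monoʳ-≤ 3 7500Q≤H ⟩
    3 * H                  ∎
    where open ≤-Reasoning
          regroup : ∀ m K → 36 * (m * K) * (500 * m) ≡ 18000 * (m * m * K)
          regroup = solve-∀

  group : ℤ → ℤ → ℤ → Tree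
  group x y z = node (node (node (leaf x) (leaf y)) (leaf (- (+ H)))) (leaf z)

  groups : ∀ {k} {xs : List ℤ} → Tree → Triples k xs → Tree
  groups base []             = base
  groups base (cons x y z t) = node (group x y z) (groups base t)

  groups-leaves : ∀ {k} {xs : List ℤ} base (t : Triples k xs) →
                  leaves (groups base t) ↭ xs ++ replicate k (- (+ H)) ++ leaves base
  groups-leaves base []             = ↭-refl
  groups-leaves base (cons {k} {xs} x y z t) =
    ↭-prep x (↭-prep y (↭-trans (↭-prep (- (+ H)) (↭-prep z (groups-leaves base t)))
                                (↭-sym (↭.shift (- (+ H)) (z ∷ xs) (replicate k (- (+ H)) ++ leaves base)))))

  group-cost : ∀ {x y z} → kind x ≡ large → kind y ≡ large → kind z ≡ large →
               thirds (group x y z) ≡ + 0 × coarseCost (group x y z) ≡ 3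
  group-cost kx ky kz = by-kinds kx ky kind-H kz
    where by-kinds : ∀ {k₁ k₂ k₃ k₄} → k₁ ≡ large → k₂ ≡ large → k₃ ≡ negative → k₄ ≡ large →
                     third k₁ ℤ.+ third k₂ ℤ.+ third k₃ ℤ.+ third k₄ ≡ + 0 ×
                     ∣ third k₁ ℤ.+ third k₂ ℤ.+ third k₃ ℤ.+ third k₄ ∣
                       + (∣ third k₁ ℤ.+ third k₂ ℤ.+ third k₃ ∣ + (∣ third k₁ ℤ.+ third k₂ ∣ + (0 + 0) + 0) + 0) ≡ 3
          by-kinds refl refl refl refl = refl , refl

  groups-cost : ∀ {k} {xs : List ℤ} base (t : Triples k xs) → All (λ x → kind x ≡ large) xs → thirds base ≡ + 0 →
                thirds (groups base t) ≡ + 0 × coarseCost (groups base t) ≡ 3 * k + coarseCost base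
  groups-cost base [] [] N≡0 = N≡0 , refl
  groups-cost base (cons {k} x y z t) (kx ∷ ky ∷ kz ∷ ks) N≡0 =
    join {group x y z} {groups base t} (group-cost {x} {y} {z} kx ky kz) (groups-cost base t ks N≡0)
    where
      join : ∀ {g r} → thirds g ≡ + 0 × coarseCost g ≡ 3 → thirds r ≡ + 0 × coarseCost r ≡ 3 * k + coarseCost base →
             thirds (node g r) ≡ + 0 × coarseCost (node g r) ≡ 3 * suc k + coarseCost base
      join {g} {r} (Ng , Cg) (Nr , Cr) = cong₂ ℤ._+_ Ng Nr , (begin
        ∣ thirds g ℤ.+ thirds r ∣ + (coarseCost g + coarseCost r)
          ≡⟨ cong₂ (λ p q → ∣ p ∣ + q) (cong₂ ℤ._+_ Ng Nr) (cong₂ _+_ Cg Cr) ⟩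
        0 + (3 + (3 * k + coarseCost base))  ≡⟨ regroup k (coarseCost base) ⟩
        3 * suc k + coarseCost base          ∎)
        where open ≡-Reasoning
              regroup : ∀ k c → 0 + (3 + (3 * k + c)) ≡ 3 * suc k + c
              regroup = solve-∀

  hComb : ℕ → Tree
  hComb zero    = leaf (+ h)
  hComb (suc k) = node (leaf (+ h)) (hComb k)

  hComb-leaves : ∀ k → leaves (hComb k) ≡ replicate (suc k) (+ h)
  hComb-leaves zero    = refl
  hComb-leaves (suc k) = cong (+ h ∷_) (hComb-leaves k)

  hComb-cost : ∀ k → thirds (hComb k) ≡ + 0 × coarseCost (hComb k) ≡ 0
  hComb-cost zero    = cong third kind-h , refl
  hComb-cost (suc k) with hComb-cost k
  ... | N≡0 , C≡0 rewrite kind-h | N≡0 | C≡0 = refl , refl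

  -- Each group ((a a) -H) a has thirds 2, -1, 0 at its internal nodes.
  T⋆ : Tree
  T⋆ = groups (hComb m′) (triples m As length-As)

  T⋆-leaves : leaves T⋆ ↭ X
  T⋆-leaves = ↭-trans (groups-leaves (hComb m′) (triples m As length-As))
                      (↭-reflexive (cong (λ hs → As ++ Ms ++ hs) (hComb-leaves m′)))

  coarseCost-T⋆ : coarseCost T⋆ ≡ 3 * m
  coarseCost-T⋆ = begin
    coarseCost T⋆                  ≡⟨ proj₂ (groups-cost {m} {As} (hComb m′) (triples m As length-As) (all-As kind-a) (proj₁ (hComb-cost m′))) ⟩
    3 * m + coarseCost (hComb m′)  ≡⟨ cong (λ c → 3 * m + c) (proj₂ (hComb-cost m′)) ⟩
    3 * m + 0                      ≡⟨ +-identityʳ (3 * m) ⟩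
    3 * m                          ∎
    where open ≡-Reasoning

  rotation-gain : ∀ i j → ∣ a i ℤ.+ a j ∣ < ∣ - (+ H) ℤ.+ a i ∣
  rotation-gain i j = begin-strict
    ∣ a i ℤ.+ a j ∣                ≡⟨⟩
    (b i + W) + (b j + W)          <⟨ m+n≤o⇒m≤o∸n (suc ((b i + W) + (b j + W))) three-summands ⟩
    H ∸ (b i + W)                  ≡⟨ ℤ.∣⊖∣-≤ ai≤H ⟨
    ∣ (b i + W) ⊖ H ∣              ≡⟨ cong ∣_∣ (ℤ.-m+n≡n⊖m H (b i + W)) ⟨
    ∣ - (+ H) ℤ.+ a i ∣            ∎
    where
      open ≤-Reasoning
      three-summands : suc ((b i + W) + (b j + W)) + (b i + W) ≤ H
      three-summands = begin
        suc ((b i + W) + (b j + W)) + (b i + W)   ≡⟨ regroup (b i) (b j) W ⟩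
        3 * W + suc (2 * b i + b j)               ≤⟨ +-monoʳ-≤ (3 * W) (+-mono-<-≤ (2b<K i) (≤-trans (b≤K j) K≤h)) ⟩
        3 * W + (K + h)                           ≡⟨ +-assoc (3 * W) K h ⟨
        H                                         ∎
        where regroup : ∀ bi bj W → suc ((bi + W) + (bj + W)) + (bi + W) ≡ 3 * W + suc (2 * bi + bj)
              regroup = solve-∀
      ai≤H : b i + W ≤ H
      ai≤H = ≤-trans (m≤n+m (b i + W) (suc ((b i + W) + (b j + W)))) three-summands

  module OptimalTree {T : Tree} (T↭X : leaves T ↭ X) (opt : Optimal X T) where

    coarseCost≤3m : coarseCost T ≤ 3 * m
    coarseCost≤3m = ≤-pred (*-cancelˡ-< H (coarseCost T) (suc (3 * m)) (begin-strict
      H * coarseCost T                                  ≤⟨ coarseCost-optimal {X} {T} {T⋆} T↭X opt T⋆-leaves ⟩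
      H * coarseCost T⋆ + 2 * (length X * sum (map deviation X))
        ≤⟨ +-mono-≤ (≤-reflexive (cong (H *_) coarseCost-T⋆))
                    (*-monoʳ-≤ 2 (*-mono-≤ (≤-reflexive length-X) deviation-X)) ⟩
      H * (3 * m) + 2 * (5 * m * budget)                <⟨ +-monoʳ-< (H * (3 * m)) 2*5m*budget<H ⟩
      H * (3 * m) + H                                   ≡⟨ +-comm (H * (3 * m)) H ⟩
      H + H * (3 * m)                                   ≡⟨ *-suc H (3 * m) ⟨
      H * suc (3 * m)                                   ∎))
      where open ≤-Reasoning

    excess≡0 : excess T ≡ 0
    excess≡0 = n≤0⇒n≡0 (+-cancelˡ-≤ (6 * m) _ _ (begin
      6 * m + excess T                                  ≡⟨ cong (_+ excess T) (+-identityʳ (6 * m)) ⟨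
      6 * m + 0 + excess T                              ≡⟨ cong₂ (λ w n → w + n + excess T) (weight-X {T} T↭X) (cong ∣_∣ N≡0) ⟨
      weight T + ∣ thirds T ∣ + excess T                ≡⟨ excess-identity T ⟩
      2 * coarseCost T + 2 * defect T                   ≡⟨ cong (λ d → 2 * coarseCost T + 2 * d) δ≡0 ⟩
      2 * coarseCost T + 0                              ≤⟨ +-monoˡ-≤ 0 (*-monoʳ-≤ 2 coarseCost≤3m) ⟩
      2 * (3 * m) + 0                                   ≡⟨ cong (_+ 0) (*-assoc 2 3 m) ⟨
      6 * m + 0                                         ∎))
      where open ≤-Reasoning
            N≡0 = thirds-X {T} T↭X
            δ≡0 : defect T ≡ 0
            δ≡0 = n≤0⇒n≡0 (subst (λ n → defect T ≤ ∣ n ∣) N≡0 (defect≤∣thirds∣ T))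

    ∈X : ∀ {t x} → t ⊑ T → x ∈ leaves t → x ∈ X
    ∈X p x∈ = ↭.∈-resp-↭ T↭X (∈-leaves-⊑ p x∈)

    cherry-members : ∀ {x y w z p} → Cherry x y z → Parent z (leaf w) p → p ⊑ T → x ∈ X × y ∈ X × w ∈ X
    cherry-members c par q = member (here refl) , member (there (here refl)) , member (there (there (here refl)))
      where member : ∀ {u} → u ∈ _ → u ∈ X
            member u∈ = ∈X q (↭.∈-resp-↭ (↭-sym (cherry-parent-leaves c par)) u∈)

    ¬rotatable : ∀ {z s p} → Parent z s p → p ⊑ T → ¬ Rotatable z s
    ¬rotatable par q (x , y , kx , ky , c , w , refl , kw) with cherry-members c par q
    ... | x∈ , y∈ , w∈ with negative∈X x∈ kx | large∈X y∈ ky | large∈X w∈ kw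
    ...   | refl | i , refl | j , refl = ≤⇒≯ (optimal-cherry T↭X opt c par q) (rotation-gain i j)

    no-deep-negative : ∀ {l r n} → node l r ⊑ T → thirds (node l r) ≡ -[1+ suc n ] → ⊥
    no-deep-negative {l} {r} q eq with ⊑-parent q
    ... | inj₁ z≡T = contradiction (trans (sym eq) (trans (cong thirds z≡T) (thirds-X {T} T↭X))) λ ()
    ... | inj₂ (s , p , par , p⊑T) =
      ¬rotatable par p⊑T (tight-forces-rotatable {l} {r} {s} eq (excess≡0⇒tight {T} {node l r} {s} {p} excess≡0 par p⊑T))

    ⊑-thirds-error : ∀ {t N} → t ⊑ T → thirds t ≡ N → ∣ + 3 ℤ.* value t ℤ.- N ℤ.* + H ∣ ≤ budget
    ⊑-thirds-error {t} q refl = begin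
      ∣ + 3 ℤ.* value t ℤ.- thirds t ℤ.* + H ∣  ≤⟨ thirds-approximation t ⟩
      leafSum deviation t                      ≤⟨ leafSum-⊑ deviation q ⟩
      leafSum deviation T                      ≡⟨ leafSum-↭ deviation {T} T↭X ⟩
      sum (map deviation X)                    ≤⟨ deviation-X ⟩
      budget                                   ∎
      where open ≤-Reasoning

    Form : ℤ → ℤ → Set
    Form N z = ∣ + 3 ℤ.* z ℤ.- N ℤ.* + H ∣ * (500 * m) ≤ 3 * H

    ⊑-form : ∀ {t N} → t ⊑ T → thirds t ≡ N → Form N (value t)
    ⊑-form q eq = ≤-trans (*-monoˡ-≤ (500 * m) (⊑-thirds-error q eq)) budget*500m≤3H

    negative-node-form : ∀ {l r} → node l r ⊑ T → value (node l r) ℤ.< + 0 →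
                         ∀ N → thirds (node l r) ≡ N → Form (+ 0) (value (node l r)) ⊎ Form (- (+ 1)) (value (node l r))
    negative-node-form q v<0 (+ zero)       eq = inj₁ (⊑-form q eq)
    negative-node-form q v<0 -[1+ zero ]    eq = inj₂ (⊑-form q eq)
    negative-node-form q v<0 (+ suc k)      eq = contradiction (≤-<-trans (⊑-thirds-error q eq) budget<H) (≤⇒≯ (H≤∣3i-[1+k]H∣ H k v<0))
    negative-node-form q v<0 -[1+ suc n ]   eq = ⊥-elim (no-deep-negative q eq)

    negative-internal-form : ∀ z → z ∈ internals T → z ℤ.< + 0 → Form (+ 0) z ⊎ Form (- (+ 1)) z
    negative-internal-form z z∈ z<0 with ∈-internals⇒⊑ T z∈
    ... | l , r , q , refl = negative-node-form q z<0 (thirds (node l r)) refl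

Wof-large : ∀ m K → 2500 * (m * m * K) ≤ Wof m K
Wof-large m K = ≤-reflexive (regroup m K)
  where regroup : ∀ m K → 2500 * (m * m * K) ≡ 100 * (5 * m * (5 * m)) * K
        regroup = solve-∀

hof-bounds : ∀ m K .{{_ : NonZero m}} → K ≤ hof m K × hof m K ≤ 4 * K
hof-bounds m K = (begin
    K                     ≡⟨ m*n/n≡m K D ⟨
    K * D / D             ≤⟨ /-monoˡ-≤ D (begin
      K * D                 ≤⟨ m≤m+n (K * D) _ ⟩
      K * D + 2 * (K * D)   ≡⟨ 3KD≡3W ⟩
      3 * Wof m K           ≤⟨ m≤m+n (3 * Wof m K) K ⟩
      Lof m K               ∎) ⟩
    Lof m K / D           ∎)
  , (begin
    Lof m K / D           ≤⟨ /-monoˡ-≤ D (begin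
      3 * Wof m K + K       ≤⟨ +-monoʳ-≤ (3 * Wof m K) (m≤m*n K D) ⟩
      3 * Wof m K + K * D   ≡⟨ cong (_+ K * D) 3KD≡3W ⟨
      K * D + 2 * (K * D) + K * D ≡⟨ four (K * D) ⟩
      4 * (K * D)           ≡⟨ *-assoc 4 K D ⟨
      4 * K * D             ∎) ⟩
    4 * K * D / D         ≡⟨ m*n/n≡m (4 * K) D ⟩
    4 * K                 ∎)
  where
    open ≤-Reasoning
    D = 2500 * (m * m)
    instance _ : NonZero D
             _ = m*n≢0 2500 (m * m) {{_}} {{m*n≢0 m m}}
    3KD≡3W : K * D + 2 * (K * D) ≡ 3 * Wof m K
    3KD≡3W = regroup m K
      where regroup : ∀ m K → K * (2500 * (m * m)) + 2 * (K * (2500 * (m * m))) ≡ 3 * (100 * (5 * m * (5 * m)) * K)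
            regroup = solve-∀
    four : ∀ x → x + 2 * x + x ≡ 4 * x
    four = solve-∀

lemma2p9 : (m K : ℕ) → .{{_ : NonZero m}} → 0 ℕ.< K →
    (b : Fin (3 ℕ.* m) → ℕ) →
    (∀ i → 0 ℕ.< b i) → (∀ i → K ℕ.< 4 ℕ.* b i) → (∀ i → 2 ℕ.* b i ℕ.< K) →
    sum (map b (allFin (3 ℕ.* m))) ≡ m ℕ.* K →
    (Tmin : Tree) → leaves Tmin ↭ Xof m K b →
    (∀ (T : Tree) → leaves T ↭ Xof m K b → cost Tmin ℕ.≤ cost T) →
    ∀ (z : ℤ) → z ∈ internals Tmin → z ℤ.< + 0 →
    FormOf m K (+ 0) z ⊎ FormOf m K (- (+ 1)) z
lemma2p9 m@(suc m′) K 0<K b _ _ 2b<K _ Tmin Tmin↭X optimal =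
  Construction.OptimalTree.negative-internal-form
    m′ K (Wof m K) (hof m K) b 0<K 2b<K (proj₁ (hof-bounds m K)) (proj₂ (hof-bounds m K)) (Wof-large m K)
    Tmin↭X optimal
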